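{- Let $q \ge 7$ be a prime power with $q \equiv 3 \pmod 4$. In $PG(2,q)$ with homogeneous coordinates $(x,y,z)$, for $k \in GF(q)$, $k \neq 0$, let $C_k$ denote the conic $\{(x,y,z) : xy + kz^2 = 0\}$. Let $b \in GF(q)$ be a non-square such that $b-1$ is also a non-square. Then $\mathcal{S} = C_1 \cup C_b \cup \{(0,0,1)\}$ is an untouchable set of size $2q+1$.
   Context: $PG(2,q)$ is the Desarguesian projective plane over $GF(q)$. An untouchable set in a projective plane is a set of points such that no line of the plane meets the set in exactly one point. "Non-square" means a nonzero element of $GF(q)$ that is not a square in $GF(q)$. -}

module Defs where

open import Level using (0ℓ)
open import Algebra.Bundles using (CommutativeRing)
open import Data.Nat using (ℕ)
open import Data.Fin using (Fin)
open import Data.Product using (Σ; ∃; _×_; _,_)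
open import Data.Sum using (_⊎_)
open import Relation.Nullary using (¬_)
open import Relation.Binary.PropositionalEquality using (_≡_)

-- Every such field is GF(q).
record IsFiniteField (R : CommutativeRing 0ℓ 0ℓ) (q : ℕ) : Set where
  open CommutativeRing R
  field
    nontrivial : ¬ (1# ≈ 0#)
    inverse    : ∀ x → ¬ (x ≈ 0#) → ∃ λ y → x * y ≈ 1#
    enum       : Fin q → Carrier
    enum-surj  : ∀ x → ∃ λ i → enum i ≈ x
    enum-inj   : ∀ i j → enum i ≈ enum j → i ≡ j

module Projective (R : CommutativeRing 0ℓ 0ℓ) where
  open CommutativeRing R

  NonZeroF : Carrier → Set
  NonZeroF x = ¬ (x ≈ 0#)

  IsSquare : Carrier → Set
  IsSquare b = ∃ λ y → y * y ≈ b

  NonSquare : Carrier → Set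
  NonSquare b = NonZeroF b × ¬ IsSquare b

  Triple : Set
  Triple = Carrier × Carrier × Carrier

  -- homogeneous coordinates of a point of PG(2,q): a nonzero triple
  record Point : Set where
    constructor pt
    field
      x y z   : Carrier
      nonzero : ¬ (x ≈ 0# × y ≈ 0# × z ≈ 0#)

  -- two coordinate vectors represent the same projective point
  Proportional : Point → Point → Set
  Proportional (pt x₁ y₁ z₁ _) (pt x₂ y₂ z₂ _) =
    ∃ λ t → NonZeroF t × (x₂ ≈ t * x₁) × (y₂ ≈ t * y₁) × (z₂ ≈ t * z₁)

  -- lines of PG(2,q) are given by nonzero coefficient triples [a,b,c];
  -- the point (x,y,z) lies on [a,b,c] iff a x + b y + c z = 0.
  Line : Set
  Line = Point

  IncidentTo : Line → Point → Set
  IncidentTo (pt a b c _) (pt x y z _) = (a * x + b * y) + c * z ≈ 0#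

  PointSet : Set₁
  PointSet = Point → Set

  Untouchable : PointSet → Set
  Untouchable S = ∀ (L : Line) →
    ¬ (Σ Point λ P → S P × IncidentTo L P ×
         (∀ Q → S Q → IncidentTo L Q → Proportional P Q))

  HasSize : PointSet → ℕ → Set
  HasSize S n = Σ (Fin n → Point) λ f →
    (∀ i → S (f i)) ×
    (∀ i j → Proportional (f i) (f j) → i ≡ j) ×
    (∀ P → S P → ∃ λ i → Proportional (f i) P)

  Conic : Carrier → PointSet
  Conic k (pt x y z _) = x * y + k * (z * z) ≈ 0#

  -- the point (0,0,1): coordinate vectors with x = y = 0 (z is then
  -- nonzero, so these are exactly the representatives of (0,0,1))
  IsP001 : PointSet
  IsP001 (pt x y _ _) = x ≈ 0# × y ≈ 0#

  SetS : Carrier → PointSet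
  SetS b P = Conic 1# P ⊎ Conic b P ⊎ IsP001 P

{-# OPTIONS --safe #-}
module Submission where

-- Let L = [a, β, c] meet S. If c = 0, L passes through (0,0,1) and meets C_1 or
-- C_b again at (k β, - k a, w) with w² = k a β: one of a β and b a β is a square, because a product
-- of two non-squares is a square. If β = 0 ≠ c, L passes through (0,1,0) and meets C_1 again.
-- Otherwise L meets S at a point (1, - k t², t) of C_k. If L is not tangent there it meets C_k
-- again; if it is tangent, it meets the other conic C_k′ at t (k ± r) / k′ with r² = k (k - k′),
-- which exists because 1 - b = (- 1)(b - 1) and b (b - 1) are products of two non-squares
-- (- 1 is a non-square since q ≡ 3 mod 4). The points (1, - t², t), (- b t², 1, t) and (0,0,1)
-- enumerate S without repetition, so |S| = 2 q + 1.
--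
-- The facts about GF(q) come from counting. A finite set and the fixed points of an involution
-- on it have sizes of the same parity: x ↦ x + 1 gives 1 + 1 ≠ 0, and x ↦ - x gives q = 1 + 2 |H|
-- for a half system H (one element of each pair ± x ≠ 0). A square root i of - 1 would make
-- x ↦ ± i x a fixed-point-free involution of H, forcing q ≡ 1 mod 4. For non-squares u and v,
-- x ↦ u x² on H and x ↦ x² off H is injective, hence onto, and a preimage of v makes u v a square.

open import Level using (0ℓ)
open import Algebra.Bundles using (CommutativeRing)
open import Data.Bool using (Bool; true; false; T; _∧_; if_then_else_)
open import Data.Bool.Properties using (T-≡)
open import Data.Fin as Fin using (Fin; _<_)
open import Data.Fin.Properties using (_≟_; _<?_; <-cmp)
open import Data.Nat as ℕ using (ℕ; _%_)
import Data.Nat.Properties as ℕ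
open import Data.Nat.DivMod using (m*n%n≡0; [m+kn]%n≡m%n; m∣n⇒o%n%m≡o%m)
open import Data.Nat.Divisibility using (divides)
open import Data.Product using (∃; _,_; proj₁; proj₂)
open import Data.Sum using (_⊎_; inj₁; inj₂; reduce)
open import Function using (_∘_; _↔_; Inverse; Equivalence)
open import Relation.Binary.Definitions using (Decidable; tri<; tri≈; tri>)
open import Relation.Binary.PropositionalEquality as ≡ using (_≡_; cong)
open import Relation.Nullary using (¬_; Dec; yes; no; does; contradiction)
open import Defs

module _ {c ℓ} (R : CommutativeRing c ℓ) where
  open CommutativeRing R

  module IntegerCoefficientSolver where
    open import Data.Integer as ℤ using (ℤ; +_; -[1+_]; _⊖_; sign; ∣_∣; _◃_)
    open import Data.Integer.Properties using ([1+m]⊖[1+n]≡m⊖n; ◃-inverse)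
    open import Data.Maybe using (map)
    open import Data.Nat using (zero; suc)
    open import Data.Nat.Properties using (+-suc)
    open import Data.Sign as Sign using (Sign)
    open import Relation.Nullary.Decidable using (dec⇒maybe)
    open import Algebra.Properties.Ring ring using (-‿involutive; -0#≈0#; -‿+-comm; -1*x≈-x)
    open import Algebra.Properties.Semiring.Mult.TCOptimised semiring using (_×_; 1+×; ×-homo-+; ×1-homo-*)
    open import Algebra.Properties.CommutativeSemigroup *-commutativeSemigroup using (interchange)
    open import Algebra.Properties.CommutativeSemigroup +-commutativeSemigroup
      renaming (interchange to +-interchange) using ()
    open import Algebra.Solver.Ring.AlmostCommutativeRing
      using (fromCommutativeRing; _-Raw-AlmostCommutative⟶_)
    open import Relation.Binary.Reasoning.Setoid setoid

    -- Algebra.Solver.Ring must decide equality of coefficients, so they are taken in ℤ and mapped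
    -- by fromℤ. The optimised _×_ makes fromℤ (+ 1) reduce to 1#, so that con (+ 1) matches 1#.
    fromℤ : ℤ → Carrier
    fromℤ (+ n)    = n × 1#
    fromℤ -[1+ n ] = - (suc n × 1#)

    private
      sgn : Sign → Carrier
      sgn Sign.+ = 1#
      sgn Sign.- = - 1#

      sgn-* : ∀ s t → sgn (s Sign.* t) ≈ sgn s * sgn t
      sgn-* Sign.+ t       = sym (*-identityˡ (sgn t))
      sgn-* Sign.- Sign.+ = sym (*-identityʳ (- 1#))
      sgn-* Sign.- Sign.- = sym (trans (-1*x≈-x (- 1#)) (-‿involutive 1#))

      fromℤ-◃ : ∀ s n → fromℤ (s ◃ n) ≈ sgn s * (n × 1#)
      fromℤ-◃ s       zero    = sym (zeroʳ (sgn s))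
      fromℤ-◃ Sign.+ (suc n) = sym (*-identityˡ _)
      fromℤ-◃ Sign.- (suc n) = sym (-1*x≈-x _)

      fromℤ-sign-abs : ∀ i → fromℤ i ≈ sgn (sign i) * (∣ i ∣ × 1#)
      fromℤ-sign-abs i = trans (reflexive (cong fromℤ (≡.sym (◃-inverse i)))) (fromℤ-◃ (sign i) ∣ i ∣)

      x+a-[x+b]≈a-b : ∀ x a b → (x + a) - (x + b) ≈ a - b
      x+a-[x+b]≈a-b x a b = begin
        (x + a) + - (x + b)    ≈⟨ +-congˡ (-‿+-comm x b) ⟨
        (x + a) + (- x + - b)  ≈⟨ +-interchange x a (- x) (- b) ⟩
        (x - x) + (a - b)      ≈⟨ +-congʳ (-‿inverseʳ x) ⟩
        0# + (a - b)           ≈⟨ +-identityˡ (a - b) ⟩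
        a - b                  ∎

      fromℤ-⊖ : ∀ m n → fromℤ (m ⊖ n) ≈ m × 1# - n × 1#
      fromℤ-⊖ zero    zero    = sym (trans (+-congˡ -0#≈0#) (+-identityʳ 0#))
      fromℤ-⊖ zero    (suc n) = sym (+-identityˡ _)
      fromℤ-⊖ (suc m) zero    = sym (trans (+-congˡ -0#≈0#) (+-identityʳ _))
      fromℤ-⊖ (suc m) (suc n) = begin
        fromℤ (suc m ⊖ suc n)            ≡⟨ cong fromℤ ([1+m]⊖[1+n]≡m⊖n m n) ⟩
        fromℤ (m ⊖ n)                    ≈⟨ fromℤ-⊖ m n ⟩
        m × 1# - n × 1#                  ≈⟨ x+a-[x+b]≈a-b 1# (m × 1#) (n × 1#) ⟨
        (1# + m × 1#) - (1# + n × 1#)    ≈⟨ +-cong (1+× m 1#) (-‿cong (1+× n 1#)) ⟨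
        suc m × 1# - suc n × 1#          ∎

      fromℤ-+ : ∀ i j → fromℤ (i ℤ.+ j) ≈ fromℤ i + fromℤ j
      fromℤ-+ (+ m)    (+ n)    = ×-homo-+ 1# m n
      fromℤ-+ (+ m)    -[1+ n ] = fromℤ-⊖ m (suc n)
      fromℤ-+ -[1+ m ] (+ n)    = trans (fromℤ-⊖ n (suc m)) (+-comm _ _)
      fromℤ-+ -[1+ m ] -[1+ n ] = begin
        - (suc (suc (m ℕ.+ n)) × 1#)         ≡⟨ cong (λ k → - (suc k × 1#)) (+-suc m n) ⟨
        - ((suc m ℕ.+ suc n) × 1#)           ≈⟨ -‿cong (×-homo-+ 1# (suc m) (suc n)) ⟩
        - (suc m × 1# + suc n × 1#)          ≈⟨ -‿+-comm _ _ ⟨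
        - (suc m × 1#) + - (suc n × 1#)      ∎

      fromℤ-* : ∀ i j → fromℤ (i ℤ.* j) ≈ fromℤ i * fromℤ j
      fromℤ-* i j = begin
        fromℤ (sign i Sign.* sign j ◃ ∣ i ∣ ℕ.* ∣ j ∣)
          ≈⟨ fromℤ-◃ (sign i Sign.* sign j) (∣ i ∣ ℕ.* ∣ j ∣) ⟩
        sgn (sign i Sign.* sign j) * ((∣ i ∣ ℕ.* ∣ j ∣) × 1#)
          ≈⟨ *-cong (sgn-* (sign i) (sign j)) (×1-homo-* ∣ i ∣ ∣ j ∣) ⟩
        (sgn (sign i) * sgn (sign j)) * (∣ i ∣ × 1# * ∣ j ∣ × 1#)
          ≈⟨ interchange _ _ _ _ ⟩
        (sgn (sign i) * ∣ i ∣ × 1#) * (sgn (sign j) * ∣ j ∣ × 1#)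
          ≈⟨ *-cong (fromℤ-sign-abs i) (fromℤ-sign-abs j) ⟨
        fromℤ i * fromℤ j ∎

      fromℤ-neg : ∀ i → fromℤ (ℤ.- i) ≈ - fromℤ i
      fromℤ-neg (+ zero)  = sym -0#≈0#
      fromℤ-neg (+ suc n) = refl
      fromℤ-neg -[1+ n ]  = sym (-‿involutive _)

    fromℤ-homomorphism : ℤ.+-*-rawRing -Raw-AlmostCommutative⟶ fromCommutativeRing R
    fromℤ-homomorphism = record
      { ⟦_⟧ = fromℤ ; +-homo = fromℤ-+ ; *-homo = fromℤ-* ; -‿homo = fromℤ-neg
      ; 0-homo = refl ; 1-homo = refl }

    open import Algebra.Solver.Ring ℤ.+-*-rawRing (fromCommutativeRing R) fromℤ-homomorphism
      (λ i j → map (λ i≡j → reflexive (cong fromℤ i≡j)) (dec⇒maybe (i ℤ.≟ j))) public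

  module LinearCombination where

    combination₁ : ∀ {t c₁ e₁} → t ≈ c₁ * e₁ → e₁ ≈ 0# → t ≈ 0#
    combination₁ t≈ e₁≈0 = trans t≈ (trans (*-congˡ e₁≈0) (zeroʳ _))

    combination₂ : ∀ {t c₁ e₁ c₂ e₂} → t ≈ c₁ * e₁ + c₂ * e₂ → e₁ ≈ 0# → e₂ ≈ 0# → t ≈ 0#
    combination₂ t≈ e₁≈0 e₂≈0 =
      trans t≈ (trans (+-cong (combination₁ refl e₁≈0) (combination₁ refl e₂≈0)) (+-identityʳ 0#))

    combination₃ : ∀ {t c₁ e₁ c₂ e₂ c₃ e₃} → t ≈ c₁ * e₁ + c₂ * e₂ + c₃ * e₃ →
                   e₁ ≈ 0# → e₂ ≈ 0# → e₃ ≈ 0# → t ≈ 0#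
    combination₃ t≈ e₁≈0 e₂≈0 e₃≈0 =
      trans t≈ (trans (+-cong (combination₂ refl e₁≈0 e₂≈0) (combination₁ refl e₃≈0)) (+-identityʳ 0#))

    combination₄ : ∀ {t c₁ e₁ c₂ e₂ c₃ e₃ c₄ e₄} → t ≈ c₁ * e₁ + c₂ * e₂ + c₃ * e₃ + c₄ * e₄ →
                   e₁ ≈ 0# → e₂ ≈ 0# → e₃ ≈ 0# → e₄ ≈ 0# → t ≈ 0#
    combination₄ t≈ e₁≈0 e₂≈0 e₃≈0 e₄≈0 = trans t≈
      (trans (+-cong (combination₃ refl e₁≈0 e₂≈0 e₃≈0) (combination₁ refl e₄≈0)) (+-identityʳ 0#))

  module DiscreteField (inverse : ∀ x → ¬ x ≈ 0# → ∃ λ y → x * y ≈ 1#) (_≈?_ : Decidable _≈_) where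

    open import Algebra.Properties.Ring ring using (x[y-z]≈xy-xz)
    open import Algebra.Properties.Group +-group
      renaming (x∙y⁻¹≈ε⇒x≈y to x-y≈0⇒x≈y; x≈y⇒x∙y⁻¹≈ε to x≈y⇒x-y≈0) using () public
    open import Algebra.Properties.Group +-group using () renaming (inverseˡ-unique to x+y≈0⇒x≈-y)
    open import Algebra.Properties.CommutativeSemigroup *-commutativeSemigroup using (xy∙z≈y∙xz; x∙yz≈y∙xz)
    open import Data.Integer using (+_)
    open IntegerCoefficientSolver
    open import Relation.Binary.Reasoning.Setoid setoid

    inv : ∀ x → ¬ x ≈ 0# → Carrier
    inv x x≉0 = proj₁ (inverse x x≉0)

    *-inv : ∀ x (x≉0 : ¬ x ≈ 0#) → x * inv x x≉0 ≈ 1#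
    *-inv x x≉0 = proj₂ (inverse x x≉0)

    x[zx⁻¹]≈z : ∀ x (x≉0 : ¬ x ≈ 0#) z → x * (z * inv x x≉0) ≈ z
    x[zx⁻¹]≈z x x≉0 z = trans (x∙yz≈y∙xz x z _) (trans (*-congˡ (*-inv x x≉0)) (*-identityʳ z))

    nonzero-cancel : ∀ {x y} → ¬ x ≈ 0# → x * y ≈ 0# → y ≈ 0#
    nonzero-cancel {x} {y} x≉0 xy≈0 = begin
      y                    ≈⟨ *-identityˡ y ⟨
      1# * y               ≈⟨ *-congʳ (*-inv x x≉0) ⟨
      (x * inv x x≉0) * y  ≈⟨ xy∙z≈y∙xz x _ y ⟩
      inv x x≉0 * (x * y)  ≈⟨ *-congˡ xy≈0 ⟩
      inv x x≉0 * 0#       ≈⟨ zeroʳ _ ⟩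
      0#                   ∎

    *-nonzero : ∀ {x y} → ¬ x ≈ 0# → ¬ y ≈ 0# → ¬ x * y ≈ 0#
    *-nonzero x≉0 y≉0 = y≉0 ∘ nonzero-cancel x≉0

    zero-product : ∀ {x y} → x * y ≈ 0# → x ≈ 0# ⊎ y ≈ 0#
    zero-product {x} xy≈0 with x ≈? 0#
    ... | yes x≈0 = inj₁ x≈0
    ... | no  x≉0 = inj₂ (nonzero-cancel x≉0 xy≈0)

    square≈0 : ∀ {x} → x * x ≈ 0# → x ≈ 0#
    square≈0 = reduce ∘ zero-product

    *-cancelˡ : ∀ {c x y} → ¬ c ≈ 0# → c * x ≈ c * y → x ≈ y
    *-cancelˡ {c} {x} {y} c≉0 cx≈cy = x-y≈0⇒x≈y x y (nonzero-cancel c≉0 (begin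
      c * (x - y)        ≈⟨ x[y-z]≈xy-xz c x y ⟩
      c * x - c * y      ≈⟨ +-congʳ cx≈cy ⟩
      c * y - c * y      ≈⟨ -‿inverseʳ (c * y) ⟩
      0#                 ∎))

    square-root-unique : ∀ {x y} → x * x ≈ y * y → x ≈ y ⊎ x ≈ - y
    square-root-unique {x} {y} x²≈y² with zero-product {x - y} {x + y} (begin
      (x - y) * (x + y)  ≈⟨ solve 2 (λ x y → (x :- y) :* (x :+ y) := x :* x :- y :* y) refl x y ⟩
      x * x - y * y      ≈⟨ +-congʳ x²≈y² ⟩
      y * y - y * y      ≈⟨ -‿inverseʳ (y * y) ⟩
      0#                 ∎)
    ... | inj₁ x-y≈0 = inj₁ (x-y≈0⇒x≈y x y x-y≈0)
    ... | inj₂ x+y≈0 = inj₂ (x+y≈0⇒x≈-y x y x+y≈0)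

    x≈-x⇒x≈0 : ¬ 1# + 1# ≈ 0# → ∀ {x} → x ≈ - x → x ≈ 0#
    x≈-x⇒x≈0 2≉0 {x} x≈-x = nonzero-cancel 2≉0 (begin
      (1# + 1#) * x  ≈⟨ solve 1 (λ x → (con (+ 1) :+ con (+ 1)) :* x := x :+ x) refl x ⟩
      x + x          ≈⟨ +-congˡ x≈-x ⟩
      x - x          ≈⟨ -‿inverseʳ x ⟩
      0#             ∎)

module FinCounting where
  open import Data.Bool.Properties using (T-∧)
  open import Data.Fin using (zero; suc; punchOut)
  open import Data.Fin.Permutation using (permutation)
  open import Data.Fin.Properties using (any?; punchOut-injective; injective⇒≤; suc-injective; 0≢1+n)
  open import Data.Nat using (_+_; _*_)
  open import Data.Nat.Properties using (+-0-commutativeMonoid; +-identityʳ; <-irrefl)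
  open import Function.Definitions using (Injective)
  open import Relation.Binary.PropositionalEquality
  open import Relation.Nullary.Decidable using (dec-true; dec-false)
  open import Algebra.Properties.CommutativeMonoid.Sum +-0-commutativeMonoid
    using (sum; sum-cong-≗; ∑-distrib-+; sum-permute)
  open ≡-Reasoning
  open Equivalence

  toWitness′ : ∀ {A : Set} (a? : Dec A) → T (does a?) → A
  toWitness′ (yes a) _ = a

  fromWitness′ : ∀ {A : Set} (a? : Dec A) → A → T (does a?)
  fromWitness′ (yes _) _ = _
  fromWitness′ (no ¬a) a = ¬a a

  indicator : Bool → ℕ
  indicator b = if b then 1 else 0

  count : ∀ {n} → (Fin n → Bool) → ℕ
  count P = sum (indicator ∘ P)

  count-cong : ∀ {n} {P Q : Fin n → Bool} → (∀ i → P i ≡ Q i) → count P ≡ count Q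
  count-cong P≗Q = sum-cong-≗ (cong indicator ∘ P≗Q)

  count-true : ∀ n → count {n} (λ _ → true) ≡ n
  count-true ℕ.zero    = refl
  count-true (ℕ.suc n) = cong ℕ.suc (count-true n)

  count-none : ∀ {n} (P : Fin n → Bool) → (∀ i → ¬ T (P i)) → count P ≡ 0
  count-none {ℕ.zero}  P none = refl
  count-none {ℕ.suc n} P none with P zero in P₀
  ... | true  = contradiction (from T-≡ P₀) (none zero)
  ... | false = count-none (P ∘ suc) (none ∘ suc)

  count-unique : ∀ {n} (P : Fin n → Bool) j → T (P j) → (∀ i → T (P i) → i ≡ j) → count P ≡ 1
  count-unique {ℕ.suc n} P zero Pj unique with P zero
  ... | true = cong ℕ.suc (count-none (P ∘ suc) (λ i → 0≢1+n ∘ sym ∘ unique (suc i)))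
  count-unique {ℕ.suc n} P (suc j) Pj unique with P zero in P₀
  ... | true  = contradiction (unique zero (from T-≡ P₀)) 0≢1+n
  ... | false = count-unique (P ∘ suc) j Pj (λ i → suc-injective ∘ unique (suc i))

  module Involution {n} (P : Fin n → Bool) (σ : Fin n → Fin n)
    (σ-closed : ∀ i → T (P i) → T (P (σ i)))
    (σ-involutive : ∀ i → T (P i) → σ (σ i) ≡ i) where

    Fixed Lower : Fin n → Bool
    Fixed i = P i ∧ does (i ≟ σ i)
    Lower i = P i ∧ does (i <? σ i)

    private
      Upper : Fin n → Bool
      Upper i = P i ∧ does (σ i <? i)

      trichotomy : ∀ b (i j : Fin n) →
        indicator b ≡ indicator (b ∧ does (i ≟ j)) + (indicator (b ∧ does (i <? j)) + indicator (b ∧ does (j <? i)))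
      trichotomy false i j = refl
      trichotomy true  i j with <-cmp i j
      ... | tri< i<j i≢j j≮i rewrite dec-false (i ≟ j) i≢j | dec-true (i <? j) i<j | dec-false (j <? i) j≮i = refl
      ... | tri≈ i≮j i≡j j≮i rewrite dec-true (i ≟ j) i≡j | dec-false (i <? j) i≮j | dec-false (j <? i) j≮i = refl
      ... | tri> i≮j i≢j j<i rewrite dec-false (i ≟ j) i≢j | dec-false (i <? j) i≮j | dec-true (j <? i) j<i = refl

      -- a permutation of all of Fin n, so that sum-permute applies
      σ′ : Fin n → Fin n
      σ′ i = if P i then σ i else i

      σ′-involutive : ∀ i → σ′ (σ′ i) ≡ i
      σ′-involutive i with P i in Pi
      ... | false rewrite Pi = refl
      ... | true  rewrite to T-≡ (σ-closed i (from T-≡ Pi)) = σ-involutive i (from T-≡ Pi)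

      Upper≗Lower∘σ′ : ∀ i → Upper i ≡ Lower (σ′ i)
      Upper≗Lower∘σ′ i with P i in Pi
      ... | false rewrite Pi = refl
      ... | true rewrite to T-≡ (σ-closed i (from T-≡ Pi)) | σ-involutive i (from T-≡ Pi) = refl

    count-involution : count P ≡ count Fixed + 2 * count Lower
    count-involution = begin
      count P
        ≡⟨ sum-cong-≗ (λ i → trichotomy (P i) i (σ i)) ⟩
      sum (λ i → indicator (Fixed i) + (indicator (Lower i) + indicator (Upper i)))
        ≡⟨ ∑-distrib-+ (indicator ∘ Fixed) _ ⟩
      count Fixed + sum (λ i → indicator (Lower i) + indicator (Upper i))
        ≡⟨ cong (count Fixed +_) (∑-distrib-+ (indicator ∘ Lower) (indicator ∘ Upper)) ⟩
      count Fixed + (count Lower + count Upper)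
        ≡⟨ cong (λ k → count Fixed + (count Lower + k)) count-Upper ⟩
      count Fixed + (count Lower + count Lower)
        ≡⟨ cong (λ k → count Fixed + (count Lower + k)) (+-identityʳ (count Lower)) ⟨
      count Fixed + 2 * count Lower ∎
      where
      count-Upper : count Upper ≡ count Lower
      count-Upper = trans (count-cong Upper≗Lower∘σ′)
        (sym (sum-permute (indicator ∘ Lower) (permutation σ′ σ′ σ′-involutive σ′-involutive)))

    count-fixedPointFree : (∀ i → T (P i) → σ i ≢ i) → count P ≡ 2 * count Lower
    count-fixedPointFree free = trans count-involution
      (cong (_+ 2 * count Lower) (count-none Fixed noFixed))
      where
      noFixed : ∀ i → ¬ T (P i ∧ does (i ≟ σ i))
      noFixed i Fi with to T-∧ Fi
      ... | Pi , fixed = free i Pi (sym (toWitness′ (i ≟ σ i) fixed))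

    count-uniqueFixed : ∀ j → T (P j) → σ j ≡ j → (∀ i → T (P i) → σ i ≡ i → i ≡ j) →
                        count P ≡ 1 + 2 * count Lower
    count-uniqueFixed j Pj σj≡j unique = trans count-involution (cong (_+ 2 * count Lower)
      (count-unique Fixed j (from T-∧ (Pj , fromWitness′ (j ≟ σ j) (sym σj≡j))) uniqueFixed))
      where
      uniqueFixed : ∀ i → T (P i ∧ does (i ≟ σ i)) → i ≡ j
      uniqueFixed i Fi with to T-∧ Fi
      ... | Pi , fixed = unique i Pi (sym (toWitness′ (i ≟ σ i) fixed))

  injective⇒surjective : ∀ {n} {f : Fin n → Fin n} → Injective _≡_ _≡_ f → ∀ k → ∃ λ i → f i ≡ k
  injective⇒surjective {ℕ.suc n} {f} f-injective k with any? (λ i → f i ≟ k)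
  ... | yes hit = hit
  ... | no miss = contradiction (injective⇒≤ punchOut∘f-injective) (<-irrefl refl)
    where
    k≢f : ∀ i → k ≢ f i
    k≢f i k≡fi = miss (i , sym k≡fi)
    punchOut∘f : Fin (ℕ.suc n) → Fin n
    punchOut∘f i = punchOut (k≢f i)
    punchOut∘f-injective : Injective _≡_ _≡_ punchOut∘f
    punchOut∘f-injective {i} {j} = f-injective ∘ punchOut-injective (k≢f i) (k≢f j)

n%4≡3⇒n%2≡1 : ∀ n → n % 4 ≡ 3 → n % 2 ≡ 1
n%4≡3⇒n%2≡1 n n%4≡3 = ≡.trans (≡.sym (m∣n⇒o%n%m≡o%m 2 4 n (divides 2 ≡.refl))) (cong (_% 2) n%4≡3)

[2*k]%2≡0 : ∀ k → (2 ℕ.* k) % 2 ≡ 0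
[2*k]%2≡0 k = ≡.trans (cong (_% 2) (ℕ.*-comm 2 k)) (m*n%n≡0 k 2)

[1+2*[2*k]]%4≡1 : ∀ k → (1 ℕ.+ 2 ℕ.* (2 ℕ.* k)) % 4 ≡ 1
[1+2*[2*k]]%4≡1 k = ≡.trans (cong (λ m → (1 ℕ.+ m) % 4) (≡.trans (≡.sym (ℕ.*-assoc 2 2 k)) (ℕ.*-comm 4 k)))
                             ([m+kn]%n≡m%n 1 k 4)

module FiniteField {R : CommutativeRing 0ℓ 0ℓ} {q : ℕ} (F : IsFiniteField R q) where
  open CommutativeRing R
  open IsFiniteField F
  open Projective R using (IsSquare; NonSquare)
  open FinCounting renaming (injective⇒surjective to Fin-injective⇒surjective)
  open IntegerCoefficientSolver R
  open import Data.Integer using (+_)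
  open import Data.Fin.Properties using (<-asym; <-irrefl; any?)
  open import Relation.Binary.PropositionalEquality using (cong₂; subst)
  open import Relation.Nullary.Decidable using (map′)
  open import Algebra.Properties.Ring ring using (-‿involutive; -0#≈0#; -‿distribʳ-*; -1*x≈-x)
  open import Algebra.Properties.Group +-group using (identityʳ-unique)
  open import Relation.Binary.Reasoning.Setoid setoid
  open Equivalence using (from)

  index : Carrier → Fin q
  index x = proj₁ (enum-surj x)

  enum-index : ∀ x → enum (index x) ≈ x
  enum-index x = proj₂ (enum-surj x)

  index-enum : ∀ i → index (enum i) ≡ i
  index-enum i = enum-inj _ _ (enum-index (enum i))

  index-cong : ∀ {x y} → x ≈ y → index x ≡ index y
  index-cong {x} {y} x≈y = enum-inj _ _ (trans (enum-index x) (trans x≈y (sym (enum-index y))))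

  index-injective : ∀ {x y} → index x ≡ index y → x ≈ y
  index-injective {x} {y} eq = trans (sym (enum-index x)) (trans (reflexive (cong enum eq)) (enum-index y))

  infix 4 _≈?_
  _≈?_ : Decidable _≈_
  x ≈? y = map′ index-injective index-cong (index x ≟ index y)

  open DiscreteField R inverse _≈?_ public

  IsSquare-cong : ∀ {x y} → x ≈ y → IsSquare x → IsSquare y
  IsSquare-cong x≈y (r , r²≈x) = r , trans r²≈x x≈y

  isSquare? : ∀ x → Dec (IsSquare x)
  isSquare? x = map′ from-index to-index (any? (λ i → enum i * enum i ≈? x))
    where
    from-index : (∃ λ i → enum i * enum i ≈ x) → IsSquare x
    from-index (i , e) = enum i , e
    to-index : IsSquare x → ∃ λ i → enum i * enum i ≈ x
    to-index (r , r²≈x) = index r , trans (*-cong (enum-index r) (enum-index r)) r²≈x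

  injective⇒surjective : (f : Carrier → Carrier) → (∀ {x y} → f x ≈ f y → x ≈ y) →
                         ∀ y → ∃ λ x → f x ≈ y
  injective⇒surjective f f-injective y with Fin-injective⇒surjective {f = index ∘ f ∘ enum}
    (enum-inj _ _ ∘ f-injective ∘ index-injective) (index y)
  ... | i , fi≡y = enum i , index-injective fi≡y

  countᶜ : (Carrier → Bool) → ℕ
  countᶜ P = count (P ∘ enum)

  module InvolutionOnCarrier (P : Carrier → Bool) (P-cong : ∀ {x y} → x ≈ y → P x ≡ P y)
    (f : Carrier → Carrier) (f-cong : ∀ {x y} → x ≈ y → f x ≈ f y)
    (f-closed : ∀ x → T (P x) → T (P (f x))) (f-involutive : ∀ x → T (P x) → f (f x) ≈ x) where

    Lowerᶜ : Carrier → Bool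
    Lowerᶜ x = P x ∧ does (index x <? index (f x))

    private
      σ : Fin q → Fin q
      σ i = index (f (enum i))

      σ-closed : ∀ i → T (P (enum i)) → T (P (enum (σ i)))
      σ-closed i Pi = subst T (P-cong (sym (enum-index _))) (f-closed _ Pi)

      σ-involutive : ∀ i → T (P (enum i)) → σ (σ i) ≡ i
      σ-involutive i Pi =
        ≡.trans (index-cong (trans (f-cong (enum-index _)) (f-involutive _ Pi))) (index-enum i)

      fixed : ∀ {i} → σ i ≡ i → f (enum i) ≈ enum i
      fixed {i} σi≡i = index-injective (≡.trans σi≡i (≡.sym (index-enum i)))

      open Involution (P ∘ enum) σ σ-closed σ-involutive

      Lower≗Lowerᶜ∘enum : ∀ i → Lower i ≡ Lowerᶜ (enum i)
      Lower≗Lowerᶜ∘enum i rewrite index-enum i = ≡.refl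

    countᶜ-fixedPointFree : (∀ x → T (P x) → ¬ f x ≈ x) → countᶜ P ≡ 2 ℕ.* countᶜ Lowerᶜ
    countᶜ-fixedPointFree free =
      ≡.trans (count-fixedPointFree (λ i Pi → free (enum i) Pi ∘ fixed))
              (cong (2 ℕ.*_) (count-cong Lower≗Lowerᶜ∘enum))

    countᶜ-uniqueFixed : ∀ a → T (P a) → f a ≈ a → (∀ x → T (P x) → f x ≈ x → x ≈ a) →
                         countᶜ P ≡ 1 ℕ.+ 2 ℕ.* countᶜ Lowerᶜ
    countᶜ-uniqueFixed a Pa fa≈a unique =
      ≡.trans (count-uniqueFixed (index a) (subst T (P-cong (sym (enum-index a))) Pa)
                 (index-cong (trans (f-cong (enum-index a)) fa≈a))
                 (λ i Pi σi≡i → ≡.trans (≡.sym (index-enum i)) (index-cong (unique (enum i) Pi (fixed σi≡i)))))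
              (cong (λ k → 1 ℕ.+ 2 ℕ.* k) (count-cong Lower≗Lowerᶜ∘enum))

  odd-order⇒1+1≉0 : q % 2 ≡ 1 → ¬ 1# + 1# ≈ 0#
  odd-order⇒1+1≉0 q%2≡1 1+1≈0 = contradiction 1≡0 λ ()
    where
    x+1+1≈x : ∀ x → (x + 1#) + 1# ≈ x
    x+1+1≈x x = trans (+-assoc x 1# 1#) (trans (+-congˡ 1+1≈0) (+-identityʳ x))
    open InvolutionOnCarrier (λ _ → true) (λ _ → ≡.refl) (_+ 1#) +-congʳ (λ _ _ → _) (λ x _ → x+1+1≈x x)
    q≡2c : q ≡ 2 ℕ.* countᶜ Lowerᶜ
    q≡2c = ≡.trans (≡.sym (count-true q))
             (countᶜ-fixedPointFree (λ x _ x+1≈x → nontrivial (identityʳ-unique x 1# x+1≈x)))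
    1≡0 : 1 ≡ 0
    1≡0 = ≡.trans (≡.sym q%2≡1) (≡.trans (cong (_% 2) q≡2c) ([2*k]%2≡0 (countᶜ Lowerᶜ)))

  -1≉0 : ¬ - 1# ≈ 0#
  -1≉0 -1≈0 = nontrivial (trans (sym (-‿involutive 1#)) (trans (-‿cong -1≈0) -0#≈0#))

  module HalfSystem (1+1≉0 : ¬ 1# + 1# ≈ 0#) where

    -- The half system: of each pair x, - x with x ≉ 0, the element of smaller index.
    positive? : Carrier → Bool
    positive? x = does (index x <? index (- x))

    positive?-cong : ∀ {x y} → x ≈ y → positive? x ≡ positive? y
    positive?-cong x≈y = cong₂ (λ i j → does (i <? j)) (index-cong x≈y) (index-cong (-‿cong x≈y))

    positive-asym : ∀ {x} → T (positive? x) → ¬ T (positive? (- x))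
    positive-asym {x} px p-x = <-asym (toWitness′ (index x <? index (- x)) px)
      (subst (index (- x) <_) (index-cong (-‿involutive x)) (toWitness′ (index (- x) <? index (- - x)) p-x))

    positive⇒nonzero : ∀ {x} → T (positive? x) → ¬ x ≈ 0#
    positive⇒nonzero {x} px x≈0 =
      <-irrefl (index-cong (trans x≈0 (sym (trans (-‿cong x≈0) -0#≈0#)))) (toWitness′ (index x <? index (- x)) px)

    positive-or-negative : ∀ {x} → ¬ x ≈ 0# → T (positive? x) ⊎ T (positive? (- x))
    positive-or-negative {x} x≉0 with <-cmp (index x) (index (- x))
    ... | tri< x<-x _ _ = inj₁ (fromWitness′ (index x <? index (- x)) x<-x)
    ... | tri≈ _ x≡-x _ = contradiction (x≈-x⇒x≈0 1+1≉0 (index-injective x≡-x)) x≉0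
    ... | tri> _ _ -x<x = inj₂ (fromWitness′ (index (- x) <? index (- - x))
                                  (subst (index (- x) <_) (≡.sym (index-cong (-‿involutive x))) -x<x))

    canon : Carrier → Carrier
    canon x = if positive? x then x else - x

    canon-± : ∀ x → canon x ≈ x ⊎ canon x ≈ - x
    canon-± x with positive? x
    ... | true  = inj₁ refl
    ... | false = inj₂ refl

    canon-cong : ∀ {x y} → x ≈ y → canon x ≈ canon y
    canon-cong {x} {y} x≈y with positive? x | positive? y | positive?-cong x≈y
    ... | true  | true  | _ = x≈y
    ... | false | false | _ = -‿cong x≈y

    canon-positive : ∀ {x} → T (positive? x) → canon x ≈ x
    canon-positive {x} px with positive? x
    ... | true = refl

    canon-nonzero : ∀ {x} → ¬ x ≈ 0# → T (positive? (canon x))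
    canon-nonzero {x} x≉0 with positive? x in px | positive-or-negative x≉0
    ... | true  | _        = from T-≡ px
    ... | false | inj₂ p-x = p-x

    canon-neg : ∀ x → canon (- x) ≈ canon x
    canon-neg x with positive? x in px | positive? (- x) in p-x
    ... | true  | true  = contradiction (from T-≡ p-x) (positive-asym (from T-≡ px))
    ... | true  | false = -‿involutive x
    ... | false | true  = refl
    ... | false | false with x ≈? 0#
    ...   | yes x≈0 = trans (-‿involutive x) (trans x≈0 (sym (trans (-‿cong x≈0) -0#≈0#)))
    ...   | no  x≉0 with positive-or-negative x≉0
    ...     | inj₁ x>0  = contradiction (subst T px x>0) λ ()
    ...     | inj₂ -x>0 = contradiction (subst T p-x -x>0) λ ()

    canon-square : ∀ x → canon x * canon x ≈ x * x
    canon-square x with canon-± x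
    ... | inj₁ c≈x  = *-cong c≈x c≈x
    ... | inj₂ c≈-x = trans (*-cong c≈-x c≈-x) (solve 1 (λ x → (:- x) :* (:- x) := x :* x) refl x)

    sign-determines-root : ∀ {x y} → positive? x ≡ positive? y → x * x ≈ y * y → x ≈ y
    sign-determines-root {x} {y} same x²≈y² with square-root-unique x²≈y²
    ... | inj₁ x≈y  = x≈y
    ... | inj₂ x≈-y with y ≈? 0#
    ...   | yes y≈0 = trans x≈-y (trans (-‿cong y≈0) (trans -0#≈0# (sym y≈0)))
    ...   | no  y≉0 with positive-or-negative y≉0
    ...     | inj₁ py  = contradiction (subst T (≡.trans (≡.sym same) (positive?-cong x≈-y)) py) (positive-asym py)
    ...     | inj₂ p-y = contradiction p-y (positive-asym (subst T (≡.trans (≡.sym (positive?-cong x≈-y)) same) p-y))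

    module NonsquareScaling {u : Carrier} (u-nonsquare : NonSquare u) where

      φ : Carrier → Carrier
      φ x = if positive? x then u * (x * x) else x * x

      u-not-ratio : ∀ {x y} → ¬ x ≈ 0# → ¬ u * (x * x) ≈ y * y
      u-not-ratio {x} {y} x≉0 ux²≈y² = proj₂ u-nonsquare (y * x⁻¹ , (begin
        (y * x⁻¹) * (y * x⁻¹)
          ≈⟨ solve 2 (λ y i → (y :* i) :* (y :* i) := (y :* y) :* (i :* i)) refl y x⁻¹ ⟩
        (y * y) * (x⁻¹ * x⁻¹)
          ≈⟨ *-congʳ ux²≈y² ⟨
        (u * (x * x)) * (x⁻¹ * x⁻¹)
          ≈⟨ solve 3 (λ u x i → (u :* (x :* x)) :* (i :* i) := u :* ((x :* i) :* (x :* i))) refl u x x⁻¹ ⟩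
        u * ((x * x⁻¹) * (x * x⁻¹))
          ≈⟨ *-congˡ (*-cong (*-inv x x≉0) (*-inv x x≉0)) ⟩
        u * (1# * 1#)
          ≈⟨ solve 1 (λ u → u :* (con (+ 1) :* con (+ 1)) := u) refl u ⟩
        u ∎))
        where x⁻¹ = inv x x≉0

      φ-injective : ∀ {x y} → φ x ≈ φ y → x ≈ y
      φ-injective {x} {y} φx≈φy with positive? x in px | positive? y in py
      ... | true  | true  = sign-determines-root (≡.trans px (≡.sym py)) (*-cancelˡ (proj₁ u-nonsquare) φx≈φy)
      ... | false | false = sign-determines-root (≡.trans px (≡.sym py)) φx≈φy
      ... | true  | false = contradiction φx≈φy (u-not-ratio (positive⇒nonzero (from T-≡ px)))
      ... | false | true  = contradiction (sym φx≈φy) (u-not-ratio (positive⇒nonzero (from T-≡ py)))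

    nonsquare*nonsquare : ∀ {u v} → NonSquare u → NonSquare v → IsSquare (u * v)
    nonsquare*nonsquare {u} {v} u-nonsquare v-nonsquare with injective⇒surjective φ φ-injective v
      where open NonsquareScaling u-nonsquare
    ... | x , φx≈v with positive? x
    ...   | true  = u * x , trans (solve 2 (λ u x → (u :* x) :* (u :* x) := u :* (u :* (x :* x))) refl u x) (*-congˡ φx≈v)
    ...   | false = contradiction (x , φx≈v) (proj₂ v-nonsquare)

    module QuarterTurn {ι : Carrier} (ι²≈-1 : ι * ι ≈ - 1#) where

      ρ : Carrier → Carrier
      ρ x = canon (ι * x)

      ι[ιx]≈-x : ∀ x → ι * (ι * x) ≈ - x
      ι[ιx]≈-x x = trans (sym (*-assoc ι ι x)) (trans (*-congʳ ι²≈-1) (-1*x≈-x x))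

      ι≉0 : ¬ ι ≈ 0#
      ι≉0 ι≈0 = -1≉0 (trans (sym ι²≈-1) (trans (*-congʳ ι≈0) (zeroˡ ι)))

      ρ-closed : ∀ x → T (positive? x) → T (positive? (ρ x))
      ρ-closed x px = canon-nonzero (*-nonzero ι≉0 (positive⇒nonzero px))

      ρ-involutive : ∀ x → T (positive? x) → ρ (ρ x) ≈ x
      ρ-involutive x px with canon-± (ι * x)
      ... | inj₁ ρx≈ιx = begin
        canon (ι * ρ x)      ≈⟨ canon-cong (*-congˡ ρx≈ιx) ⟩
        canon (ι * (ι * x))  ≈⟨ canon-cong (ι[ιx]≈-x x) ⟩
        canon (- x)          ≈⟨ canon-neg x ⟩
        canon x              ≈⟨ canon-positive px ⟩
        x                    ∎
      ... | inj₂ ρx≈-ιx = begin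
        canon (ι * ρ x)        ≈⟨ canon-cong (*-congˡ ρx≈-ιx) ⟩
        canon (ι * - (ι * x))  ≈⟨ canon-cong (-‿distribʳ-* ι (ι * x)) ⟨
        canon (- (ι * (ι * x))) ≈⟨ canon-cong (-‿cong (ι[ιx]≈-x x)) ⟩
        canon (- - x)          ≈⟨ canon-cong (-‿involutive x) ⟩
        canon x                ≈⟨ canon-positive px ⟩
        x                      ∎

      ρ-fixedPointFree : ∀ x → T (positive? x) → ¬ ρ x ≈ x
      ρ-fixedPointFree x px ρx≈x = positive⇒nonzero px (square≈0 (x≈-x⇒x≈0 1+1≉0 (begin
        x * x              ≈⟨ *-cong ρx≈x ρx≈x ⟨
        ρ x * ρ x          ≈⟨ canon-square (ι * x) ⟩
        (ι * x) * (ι * x)  ≈⟨ solve 2 (λ ι x → (ι :* x) :* (ι :* x) := ι :* (ι :* (x :* x))) refl ι x ⟩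
        ι * (ι * (x * x))  ≈⟨ ι[ιx]≈-x (x * x) ⟩
        - (x * x)          ∎)))

  -1-nonsquare : q % 4 ≡ 3 → NonSquare (- 1#)
  -1-nonsquare q%4≡3 = -1≉0 , -1-not-square
    where
    1+1≉0 = odd-order⇒1+1≉0 (n%4≡3⇒n%2≡1 q q%4≡3)
    open HalfSystem 1+1≉0
    module Negation =
      InvolutionOnCarrier (λ _ → true) (λ _ → ≡.refl) -_ -‿cong (λ _ _ → _) (λ x _ → -‿involutive x)

    q≡1+2*positives : q ≡ 1 ℕ.+ 2 ℕ.* countᶜ positive?
    q≡1+2*positives = ≡.trans (≡.sym (count-true q))
      (Negation.countᶜ-uniqueFixed 0# _ -0#≈0# (λ x _ -x≈x → x≈-x⇒x≈0 1+1≉0 (sym -x≈x)))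

    -1-not-square : ¬ IsSquare (- 1#)
    -1-not-square (ι , ι²≈-1) = contradiction 3≡1 λ ()
      where
      open QuarterTurn ι²≈-1
      module Rotation = InvolutionOnCarrier positive? positive?-cong ρ (canon-cong ∘ *-congˡ) ρ-closed ρ-involutive
      positives≡2k : countᶜ positive? ≡ 2 ℕ.* countᶜ Rotation.Lowerᶜ
      positives≡2k = Rotation.countᶜ-fixedPointFree ρ-fixedPointFree
      q≡1+4k : q ≡ 1 ℕ.+ 2 ℕ.* (2 ℕ.* countᶜ Rotation.Lowerᶜ)
      q≡1+4k = ≡.trans q≡1+2*positives (cong (λ k → 1 ℕ.+ 2 ℕ.* k) positives≡2k)
      3≡1 : 3 ≡ 1
      3≡1 = ≡.trans (≡.sym q%4≡3) (≡.trans (cong (_% 4) q≡1+4k) ([1+2*[2*k]]%4≡1 (countᶜ Rotation.Lowerᶜ)))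

module _ (R : CommutativeRing 0ℓ 0ℓ) where
  open CommutativeRing R

  module ProjectivePlane (1≉0 : ¬ 1# ≈ 0#) (inverse : ∀ x → ¬ x ≈ 0# → ∃ λ y → x * y ≈ 1#)
                         (_≈?_ : Decidable _≈_) where
    open import Data.Integer using (+_)
    open import Data.Product using (_×_)

    open Projective R
    open DiscreteField R inverse _≈?_
    open IntegerCoefficientSolver R
    open LinearCombination R
    open import Algebra.Properties.Ring ring using (-0#≈0#)
    open import Algebra.Properties.Group +-group using () renaming (⁻¹-injective to -‿injective)
    open import Relation.Binary.Reasoning.Setoid setoid

    O Y : Point
    O = pt 0# 0# 1# (λ (_ , _ , 1≈0) → 1≉0 1≈0)
    Y = pt 0# 1# 0# (λ (_ , 1≈0 , _) → 1≉0 1≈0)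

    Proportional-sym : ∀ {P Q} → Proportional P Q → Proportional Q P
    Proportional-sym {pt x₁ y₁ z₁ _} {pt x₂ y₂ z₂ _} (t , t≉0 , x₂≈ , y₂≈ , z₂≈) =
      t⁻¹ , t⁻¹≉0 , unscale x₂≈ , unscale y₂≈ , unscale z₂≈
      where
      t⁻¹ = inv t t≉0
      t⁻¹≉0 : ¬ t⁻¹ ≈ 0#
      t⁻¹≉0 t⁻¹≈0 = 1≉0 (trans (sym (*-inv t t≉0)) (trans (*-congˡ t⁻¹≈0) (zeroʳ t)))
      unscale : ∀ {u v} → v ≈ t * u → u ≈ t⁻¹ * v
      unscale {u} {v} v≈tu = begin
        u              ≈⟨ *-identityˡ u ⟨
        1# * u         ≈⟨ *-congʳ (trans (*-comm t⁻¹ t) (*-inv t t≉0)) ⟨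
        (t⁻¹ * t) * u  ≈⟨ *-assoc t⁻¹ t u ⟩
        t⁻¹ * (t * u)  ≈⟨ *-congˡ v≈tu ⟨
        t⁻¹ * v        ∎

    Proportional-trans : ∀ {P Q S} → Proportional P Q → Proportional Q S → Proportional P S
    Proportional-trans {pt x₁ y₁ z₁ _} {pt x₂ y₂ z₂ _} {pt x₃ y₃ z₃ _}
      (s , s≉0 , x₂≈ , y₂≈ , z₂≈) (t , t≉0 , x₃≈ , y₃≈ , z₃≈) =
      t * s , *-nonzero t≉0 s≉0 , rescale x₃≈ x₂≈ , rescale y₃≈ y₂≈ , rescale z₃≈ z₂≈
      where
      rescale : ∀ {u v w} → w ≈ t * v → v ≈ s * u → w ≈ (t * s) * u
      rescale w≈tv v≈su = trans w≈tv (trans (*-congˡ v≈su) (sym (*-assoc t s _)))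

    incident-proportional : ∀ {L P Q} → Proportional P Q → IncidentTo L P → IncidentTo L Q
    incident-proportional {pt a b c _} {pt x₁ y₁ z₁ _} {pt x₂ y₂ z₂ _} (t , _ , x₂≈ , y₂≈ , z₂≈) P∈L =
      begin
      (a * x₂ + b * y₂) + c * z₂
        ≈⟨ +-cong (+-cong (*-congˡ x₂≈) (*-congˡ y₂≈)) (*-congˡ z₂≈) ⟩
      (a * (t * x₁) + b * (t * y₁)) + c * (t * z₁)
        ≈⟨ solve 7 (λ a b c t x y z → (a :* (t :* x) :+ b :* (t :* y)) :+ c :* (t :* z)
                                      := t :* ((a :* x :+ b :* y) :+ c :* z)) refl a b c t x₁ y₁ z₁ ⟩
      t * ((a * x₁ + b * y₁) + c * z₁)             ≈⟨ *-congˡ P∈L ⟩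
      t * 0#                                       ≈⟨ zeroʳ t ⟩
      0#                                           ∎

    record Secant (S : PointSet) (L : Line) : Set where
      field
        P₁ P₂  : Point
        P₁∈S   : S P₁
        P₂∈S   : S P₂
        P₁∈L   : IncidentTo L P₁
        P₂∈L   : IncidentTo L P₂
        P₁≁P₂  : ¬ Proportional P₁ P₂

    untouchable-if-secants : ∀ {S} → (∀ L P → S P → IncidentTo L P → Secant S L) → Untouchable S
    untouchable-if-secants secant L (P , P∈S , P∈L , all-on-L) =
      P₁≁P₂ (Proportional-trans {P₁} {P} {P₂} (Proportional-sym {P} {P₁} (all-on-L P₁ P₁∈S P₁∈L))
                                               (all-on-L P₂ P₂∈S P₂∈L))
      where open Secant (secant L P P∈S P∈L)

    hasSize-by-parametrisation : ∀ {S n} {I : Set} → Fin n ↔ I → (g : I → Point) → (∀ i → S (g i)) →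
      (∀ i j → Proportional (g i) (g j) → i ≡ j) → (∀ P → S P → ∃ λ i → Proportional (g i) P) → HasSize S n
    hasSize-by-parametrisation {S} e g g∈S g-injective g-surjective =
      g ∘ to , g∈S ∘ to , injective , surjective
      where
      open Inverse e
      injective : ∀ i j → Proportional (g (to i)) (g (to j)) → i ≡ j
      injective i j p = ≡.trans (≡.sym (strictlyInverseʳ i))
                          (≡.trans (≡.cong from (g-injective _ _ p)) (strictlyInverseʳ j))
      surjective : ∀ P → S P → ∃ λ i → Proportional (g (to i)) P
      surjective P P∈S with g-surjective P P∈S
      ... | i , p = from i , ≡.subst (λ k → Proportional (g k) P) (≡.sym (strictlyInverseˡ i)) p

    conicPoint : Carrier → Carrier → Point
    conicPoint k t = pt 1# (- (k * (t * t))) t (λ (1≈0 , _) → 1≉0 1≈0)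

    conicPoint∈Conic : ∀ k t → Conic k (conicPoint k t)
    conicPoint∈Conic = solve 2 (λ k t → con (+ 1) :* (:- (k :* (t :* t))) :+ k :* (t :* t) := con (+ 0)) refl

    conicPoint-injective : ∀ {k k′ t s} → Proportional (conicPoint k t) (conicPoint k′ s) → t ≈ s
    conicPoint-injective {t = t} (μ , _ , 1≈μ1 , _ , s≈μt) =
      sym (trans s≈μt (trans (*-congʳ (sym (trans 1≈μ1 (*-identityʳ μ)))) (*-identityˡ t)))

    conic-x≈0⇒z≈0 : ∀ {k} P → ¬ k ≈ 0# → Conic k P → Point.x P ≈ 0# → Point.z P ≈ 0#
    conic-x≈0⇒z≈0 {k} (pt x y z _) k≉0 P∈C x≈0 = square≈0 (nonzero-cancel k≉0
      (combination₂ (solve 4 (λ k x y z → k :* (z :* z) := con (+ 1) :* (x :* y :+ k :* (z :* z)) :+ (:- y) :* x)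
                      refl k x y z) P∈C x≈0))

    conic-chart : ∀ {k t} P → Conic k P → ¬ Point.x P ≈ 0# → Point.x P * t ≈ Point.z P →
                  Proportional (conicPoint k t) P
    conic-chart {k} {t} (pt x y z _) P∈C x≉0 xt≈z = x , x≉0 , sym (*-identityʳ x) , y≈ , sym xt≈z
      where
      y≈ : y ≈ x * (- (k * (t * t)))
      y≈ = x-y≈0⇒x≈y _ _ (nonzero-cancel x≉0 (combination₂
        (solve 5 (λ k x y z t → x :* (y :- x :* (:- (k :* (t :* t))))
                    := con (+ 1) :* (x :* y :+ k :* (z :* z)) :+ (:- (k :* (z :+ x :* t))) :* (z :- x :* t))
          refl k x y z t)
        P∈C (x≈y⇒x-y≈0 (sym xt≈z))))

    conic-z≈0 : ∀ {k} P → Point.x P * Point.y P ≈ 0# → Point.z P ≈ 0# → Conic k P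
    conic-z≈0 {k} (pt x y z _) xy≈0 z≈0 =
      combination₂ (solve 4 (λ k x y z → x :* y :+ k :* (z :* z) := con (+ 1) :* (x :* y) :+ (k :* z) :* z)
                     refl k x y z) xy≈0 z≈0

    swapXY : Point → Point
    swapXY (pt x y z nz) = pt y x z (λ (y≈0 , x≈0 , z≈0) → nz (x≈0 , y≈0 , z≈0))

    swapXY-conic : ∀ {k} P → Conic k P → Conic k (swapXY P)
    swapXY-conic (pt x y z _) P∈C = trans (+-congʳ (*-comm y x)) P∈C

    swapXY-proportional : ∀ P Q → Proportional P Q → Proportional (swapXY P) (swapXY Q)
    swapXY-proportional (pt _ _ _ _) (pt _ _ _ _) (μ , μ≉0 , x≈ , y≈ , z≈) = μ , μ≉0 , y≈ , x≈ , z≈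

    module Secants {S : PointSet} where

      secant-through-O-and-Cₖ : ∀ {k a β c nz} → S O → (∀ P → Conic k P → S P) → ¬ k ≈ 0# → c ≈ 0# →
                         IsSquare (k * (a * β)) → Secant S (pt a β c nz)
      secant-through-O-and-Cₖ {k} {a} {β} {c} {nz} O∈S Cₖ⊆S k≉0 c≈0 (w , w²≈kaβ) = record
        { P₁ = O ; P₂ = Q ; P₁∈S = O∈S ; P₂∈S = Cₖ⊆S Q Q∈Cₖ
        ; P₁∈L = O∈L ; P₂∈L = Q∈L ; P₁≁P₂ = O≁Q }
        where
        kβ,ka≉0 : ¬ (k * β ≈ 0# × - (k * a) ≈ 0#)
        kβ,ka≉0 (kβ≈0 , -ka≈0) =
          nz (nonzero-cancel k≉0 (-‿injective (trans -ka≈0 (sym -0#≈0#))) , nonzero-cancel k≉0 kβ≈0 , c≈0)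
        Q : Point
        Q = pt (k * β) (- (k * a)) w (λ (kβ≈0 , -ka≈0 , _) → kβ,ka≉0 (kβ≈0 , -ka≈0))
        Q∈Cₖ : Conic k Q
        Q∈Cₖ = combination₁ (solve 4 (λ k a β w → (k :* β) :* (:- (k :* a)) :+ k :* (w :* w)
                                                 := k :* (w :* w :- k :* (a :* β))) refl k a β w)
                             (x≈y⇒x-y≈0 w²≈kaβ)
        O∈L : IncidentTo (pt a β c nz) O
        O∈L = combination₁ (solve 3 (λ a β c → (a :* con (+ 0) :+ β :* con (+ 0)) :+ c :* con (+ 1)
                                               := con (+ 1) :* c) refl a β c) c≈0
        Q∈L : IncidentTo (pt a β c nz) Q
        Q∈L = combination₁ (solve 5 (λ k a β c w → (a :* (k :* β) :+ β :* (:- (k :* a))) :+ c :* w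
                                                   := w :* c) refl k a β c w) c≈0
        O≁Q : ¬ Proportional O Q
        O≁Q (μ , _ , kβ≈μ0 , -ka≈μ0 , _) = kβ,ka≉0 (trans kβ≈μ0 (zeroʳ μ) , trans -ka≈μ0 (zeroʳ μ))

      secant-through-Y-and-Cₖ : ∀ {k a β c nz} → (∀ P → Conic k P → S P) → β ≈ 0# → ¬ c ≈ 0# →
                                Secant S (pt a β c nz)
      secant-through-Y-and-Cₖ {k} {a} {β} {c} {nz} Cₖ⊆S β≈0 c≉0 = record
        { P₁ = Y ; P₂ = Q ; P₁∈S = Cₖ⊆S Y Y∈Cₖ ; P₂∈S = Cₖ⊆S Q Q∈Cₖ
        ; P₁∈L = Y∈L ; P₂∈L = Q∈L ; P₁≁P₂ = Y≁Q }
        where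
        Q : Point
        Q = pt (c * c) (- (k * (a * a))) (- (a * c)) (λ (c²≈0 , _) → c≉0 (square≈0 c²≈0))
        Y∈Cₖ : Conic k Y
        Y∈Cₖ = solve 1 (λ k → con (+ 0) :* con (+ 1) :+ k :* (con (+ 0) :* con (+ 0)) := con (+ 0)) refl k
        Q∈Cₖ : Conic k Q
        Q∈Cₖ = solve 3 (λ k a c → (c :* c) :* (:- (k :* (a :* a))) :+ k :* ((:- (a :* c)) :* (:- (a :* c)))
                                := con (+ 0)) refl k a c
        Y∈L : IncidentTo (pt a β c nz) Y
        Y∈L = combination₁ (solve 3 (λ a β c → (a :* con (+ 0) :+ β :* con (+ 1)) :+ c :* con (+ 0)
                                               := con (+ 1) :* β) refl a β c) β≈0
        Q∈L : IncidentTo (pt a β c nz) Q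
        Q∈L = combination₁ (solve 4 (λ k a β c → (a :* (c :* c) :+ β :* (:- (k :* (a :* a)))) :+ c :* (:- (a :* c))
                                                 := (:- (k :* (a :* a))) :* β) refl k a β c) β≈0
        Y≁Q : ¬ Proportional Y Q
        Y≁Q (μ , _ , c²≈μ0 , _) = c≉0 (square≈0 (trans c²≈μ0 (zeroʳ μ)))

      secant-nontangent : ∀ {k a β c nz} t → (∀ P → Conic k P → S P) → ¬ k ≈ 0# → ¬ β ≈ 0# →
        IncidentTo (pt a β c nz) (conicPoint k t) → ¬ c ≈ (1# + 1#) * (β * (k * t)) → Secant S (pt a β c nz)
      secant-nontangent {k} {a} {β} {c} {nz} t Cₖ⊆S k≉0 β≉0 t∈L nontangent = record
        { P₁ = conicPoint k t ; P₂ = conicPoint k s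
        ; P₁∈S = Cₖ⊆S _ (conicPoint∈Conic k t) ; P₂∈S = Cₖ⊆S _ (conicPoint∈Conic k s)
        ; P₁∈L = t∈L ; P₂∈L = s∈L ; P₁≁P₂ = t≁s }
        where
        -- s is the other root of β k s² - c s - a = 0 (Vieta).
        βk≉0 = *-nonzero β≉0 k≉0
        m = inv (β * k) βk≉0
        s = c * m - t
        βkm-1≈0 : (β * k) * m - 1# ≈ 0#
        βkm-1≈0 = x≈y⇒x-y≈0 (*-inv (β * k) βk≉0)
        s∈L : IncidentTo (pt a β c nz) (conicPoint k s)
        s∈L = combination₂ (solve 6 (λ a β c k t m →
                (a :* con (+ 1) :+ β :* (:- (k :* ((c :* m :- t) :* (c :* m :- t))))) :+ c :* (c :* m :- t)
                := con (+ 1) :* ((a :* con (+ 1) :+ β :* (:- (k :* (t :* t)))) :+ c :* t)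
                   :+ (:- (((c :* m :- t) :- t) :* c)) :* ((β :* k) :* m :- con (+ 1))) refl a β c k t m)
              t∈L βkm-1≈0
        t≁s : ¬ Proportional (conicPoint k t) (conicPoint k s)
        t≁s t~s = nontangent (x-y≈0⇒x≈y _ _ (combination₂ (solve 5 (λ β c k t m →
                c :- con (+ 2) :* (β :* (k :* t))
                := (β :* k) :* ((c :* m :- t) :- t) :+ (:- c) :* ((β :* k) :* m :- con (+ 1)))
                refl β c k t m) (x≈y⇒x-y≈0 (sym (conicPoint-injective t~s))) βkm-1≈0))

      secant-tangent : ∀ {k k′ a β c nz} t → (∀ P → Conic k P → S P) → (∀ P → Conic k′ P → S P) →
        ¬ k′ ≈ 0# → ¬ k ≈ k′ → IsSquare (k * (k - k′)) → ¬ c ≈ 0# →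
        IncidentTo (pt a β c nz) (conicPoint k t) → c ≈ (1# + 1#) * (β * (k * t)) → Secant S (pt a β c nz)
      secant-tangent {k} {k′} {a} {β} {c} {nz} t Cₖ⊆S Cₖ′⊆S k′≉0 k≉k′ (r , r²≈k[k-k′]) c≉0 t∈L tangent =
        record
        { P₁ = conicPoint k t ; P₂ = conicPoint k′ s
        ; P₁∈S = Cₖ⊆S _ (conicPoint∈Conic k t) ; P₂∈S = Cₖ′⊆S _ (conicPoint∈Conic k′ s)
        ; P₁∈L = t∈L ; P₂∈L = s∈L ; P₁≁P₂ = t≁s }
        where
        -- Tangency at t means c = 2 β k t and a = - β k t², so L meets C_k′ where
        -- k′ s² - 2 k t s + k t² = 0, that is at s = t (k ± r) / k′.
        m = inv k′ k′≉0
        s = (t * (k + r)) * m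
        k′m-1≈0 : k′ * m - 1# ≈ 0#
        k′m-1≈0 = x≈y⇒x-y≈0 (*-inv k′ k′≉0)
        r²-k[k-k′]≈0 : r * r - k * (k - k′) ≈ 0#
        r²-k[k-k′]≈0 = x≈y⇒x-y≈0 r²≈k[k-k′]
        s∈L : IncidentTo (pt a β c nz) (conicPoint k′ s)
        s∈L = combination₄ (solve 8 (λ a β c k k′ t r m →
                (a :* con (+ 1) :+ β :* (:- (k′ :* (((t :* (k :+ r)) :* m) :* ((t :* (k :+ r)) :* m)))))
                  :+ c :* ((t :* (k :+ r)) :* m)
                := con (+ 1) :* ((a :* con (+ 1) :+ β :* (:- (k :* (t :* t)))) :+ c :* t)
                   :+ (((t :* (k :+ r)) :* m) :- t) :* (c :- con (+ 2) :* (β :* (k :* t)))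
                   :+ (:- (β :* ((t :* t) :* m))) :* (r :* r :- k :* (k :- k′))
                   :+ (:- (β :* ((t :* t) :* ((k :+ r) :* (k :+ r)) :* m :- k :* (t :* t)))) :* (k′ :* m :- con (+ 1)))
                refl a β c k k′ t r m)
              t∈L (x≈y⇒x-y≈0 tangent) r²-k[k-k′]≈0 k′m-1≈0
        t≁s : ¬ Proportional (conicPoint k t) (conicPoint k′ s)
        t≁s t~s with zero-product [k′-k]t²≈0
          where
          [k′-k]t²≈0 : (k′ - k) * (t * t) ≈ 0#
          [k′-k]t²≈0 = combination₃ (solve 5 (λ k k′ t r m →
              (k′ :- k) :* (t :* t)
              := ((t :* t) :* m) :* (r :* r :- k :* (k :- k′))
                 :+ ((t :* t) :* ((k :+ r) :* (k :+ r)) :* m :- k :* (t :* t)) :* (k′ :* m :- con (+ 1))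
                 :+ (:- (k′ :* (((t :* (k :+ r)) :* m) :+ t) :- con (+ 2) :* (k :* t))) :* (((t :* (k :+ r)) :* m) :- t))
              refl k k′ t r m) r²-k[k-k′]≈0 k′m-1≈0 (x≈y⇒x-y≈0 (sym (conicPoint-injective t~s)))
        ... | inj₁ k′-k≈0 = k≉k′ (sym (x-y≈0⇒x≈y k′ k k′-k≈0))
        ... | inj₂ t²≈0   = c≉0 (trans tangent (trans (*-congˡ (*-congˡ (*-congˡ (square≈0 t²≈0))))
          (solve 2 (λ β k → (con (+ 1) :+ con (+ 1)) :* (β :* (k :* con (+ 0))) := con (+ 0)) refl β k)))

      secant-through-Cₖ-point : ∀ {k k′ a β c nz} P → (∀ P → Conic k P → S P) → (∀ P → Conic k′ P → S P) →
        ¬ k ≈ 0# → ¬ k′ ≈ 0# → ¬ k ≈ k′ → IsSquare (k * (k - k′)) → ¬ β ≈ 0# → ¬ c ≈ 0# →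
        Conic k P → IncidentTo (pt a β c nz) P → Secant S (pt a β c nz)
      secant-through-Cₖ-point {k} {k′} {a} {β} {c} {nz} P@(pt x y z nzP) Cₖ⊆S Cₖ′⊆S k≉0 k′≉0 k≉k′ k[k-k′]-square
                              β≉0 c≉0 P∈C P∈L with x ≈? 0#
      ... | yes x≈0 = contradiction β≈0 β≉0
        where
        z≈0 = conic-x≈0⇒z≈0 P k≉0 P∈C x≈0
        β≈0 : β ≈ 0#
        β≈0 = nonzero-cancel (λ y≈0 → nzP (x≈0 , y≈0 , z≈0)) (trans (*-comm y β) (combination₃
          (solve 6 (λ a β c x y z → β :* y := con (+ 1) :* ((a :* x :+ β :* y) :+ c :* z) :+ (:- a) :* x :+ (:- c) :* z)
            refl a β c x y z) P∈L x≈0 z≈0))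
      ... | no x≉0 = through-chart-point (c ≈? ((1# + 1#) * (β * (k * t))))
        where
        t = z * inv x x≉0
        t∈L : IncidentTo (pt a β c nz) (conicPoint k t)
        t∈L = incident-proportional {pt a β c nz} {P} {conicPoint k t}
                (Proportional-sym {conicPoint k t} {P} (conic-chart P P∈C x≉0 (x[zx⁻¹]≈z x x≉0 z))) P∈L
        through-chart-point : Dec (c ≈ (1# + 1#) * (β * (k * t))) → Secant S (pt a β c nz)
        through-chart-point (yes tangent)    =
          secant-tangent t Cₖ⊆S Cₖ′⊆S k′≉0 k≉k′ k[k-k′]-square c≉0 t∈L tangent
        through-chart-point (no  nontangent) = secant-nontangent t Cₖ⊆S k≉0 β≉0 t∈L nontangent

module _ {R : CommutativeRing 0ℓ 0ℓ} where
  open CommutativeRing R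
  open Projective R

  module ConicPairUnion {q : ℕ} (F : IsFiniteField R q) (q%4≡3 : q % 4 ≡ 3)
    (b : Carrier) (b-nonsquare : NonSquare b) (b-1-nonsquare : NonSquare (b - 1#)) where

    open import Data.Integer using (+_)
    open import Data.Fin.Properties using (+↔⊎)
    open import Data.Sum.Function.Propositional using (_⊎-↔_)
    open import Function.Construct.Composition using (_↔-∘_)
    open import Function.Construct.Identity using (↔-id)
    open IsFiniteField F using (nontrivial; inverse; enum; enum-inj)
    open FiniteField F
    open HalfSystem (odd-order⇒1+1≉0 (n%4≡3⇒n%2≡1 q q%4≡3)) using (nonsquare*nonsquare)
    open ProjectivePlane R nontrivial inverse _≈?_
    open Secants
    open IntegerCoefficientSolver R
    open LinearCombination R

    C₁⊆S : ∀ P → Conic 1# P → SetS b P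
    C₁⊆S _ = inj₁

    Cb⊆S : ∀ P → Conic b P → SetS b P
    Cb⊆S _ = inj₂ ∘ inj₁

    O∈S : SetS b O
    O∈S = inj₂ (inj₂ (refl , refl))

    b≉0 : ¬ b ≈ 0#
    b≉0 = proj₁ b-nonsquare

    b≉1 : ¬ b ≈ 1#
    b≉1 b≈1 = proj₁ b-1-nonsquare (x≈y⇒x-y≈0 b≈1)

    1-b-square : IsSquare (1# * (1# - b))
    1-b-square = IsSquare-cong (solve 1 (λ b → (:- con (+ 1)) :* (b :- con (+ 1)) := con (+ 1) :* (con (+ 1) :- b)) refl b)
                   (nonsquare*nonsquare (-1-nonsquare q%4≡3) b-1-nonsquare)

    secant-through-O : ∀ {a β c nz} → c ≈ 0# → Secant (SetS b) (pt a β c nz)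
    secant-through-O {a} {β} c≈0 with isSquare? (a * β)
    ... | yes aβ-square    =
      secant-through-O-and-Cₖ O∈S C₁⊆S nontrivial c≈0 (IsSquare-cong (sym (*-identityˡ _)) aβ-square)
    ... | no  aβ-nonsquare =
      secant-through-O-and-Cₖ O∈S Cb⊆S b≉0 c≈0 (nonsquare*nonsquare b-nonsquare (aβ≉0 , aβ-nonsquare))
      where
      aβ≉0 : ¬ a * β ≈ 0#
      aβ≉0 aβ≈0 = aβ-nonsquare (0# , trans (zeroˡ 0#) (sym aβ≈0))

    secant : ∀ L P → SetS b P → IncidentTo L P → Secant (SetS b) L
    secant (pt a β c nz) P@(pt x y z nzP) P∈S P∈L with c ≈? 0# | β ≈? 0# | P∈S
    ... | yes c≈0 | _       | _                 = secant-through-O c≈0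
    ... | no  c≉0 | yes β≈0 | _                 = secant-through-Y-and-Cₖ C₁⊆S β≈0 c≉0
    ... | no  c≉0 | no  β≉0 | inj₁ P∈C₁         =
      secant-through-Cₖ-point P C₁⊆S Cb⊆S nontrivial b≉0 (b≉1 ∘ sym) 1-b-square β≉0 c≉0 P∈C₁ P∈L
    ... | no  c≉0 | no  β≉0 | inj₂ (inj₁ P∈Cb)  =
      secant-through-Cₖ-point P Cb⊆S C₁⊆S b≉0 nontrivial b≉1 (nonsquare*nonsquare b-nonsquare b-1-nonsquare)
                              β≉0 c≉0 P∈Cb P∈L
    ... | no  c≉0 | no  β≉0 | inj₂ (inj₂ (x≈0 , y≈0)) = contradiction c≈0 c≉0
      where
      c≈0 : c ≈ 0#
      c≈0 = nonzero-cancel (λ z≈0 → nzP (x≈0 , y≈0 , z≈0)) (trans (*-comm z c) (combination₃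
        (solve 6 (λ a β c x y z → c :* z := con (+ 1) :* ((a :* x :+ β :* y) :+ c :* z) :+ (:- a) :* x :+ (:- β) :* y)
          refl a β c x y z) P∈L x≈0 y≈0))

    untouchable : Untouchable (SetS b)
    untouchable = untouchable-if-secants secant

    Index : Set
    Index = (Fin q ⊎ Fin q) ⊎ Fin 1

    param : Index → Point
    param (inj₁ (inj₁ i)) = conicPoint 1# (enum i)
    param (inj₁ (inj₂ i)) = swapXY (conicPoint b (enum i))
    param (inj₂ _)        = O

    param∈S : ∀ i → SetS b (param i)
    param∈S (inj₁ (inj₁ i)) = C₁⊆S (param (inj₁ (inj₁ i))) (conicPoint∈Conic 1# (enum i))
    param∈S (inj₁ (inj₂ i)) =
      Cb⊆S (param (inj₁ (inj₂ i))) (swapXY-conic (conicPoint b (enum i)) (conicPoint∈Conic b (enum i)))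
    param∈S (inj₂ _)        = O∈S

    C₁-chart≁Cb-chart : ∀ t s → ¬ Proportional (conicPoint 1# t) (swapXY (conicPoint b s))
    C₁-chart≁Cb-chart t s (μ , _ , -bs²≈μ1 , 1≈μ[-t²] , _) = proj₂ b-nonsquare (b * (s * t) , x-y≈0⇒x≈y _ _
      (combination₂ (solve 4 (λ b μ s t → (b :* (s :* t)) :* (b :* (s :* t)) :- b
                       := (:- (b :* (t :* t))) :* ((:- (b :* (s :* s))) :- μ :* con (+ 1))
                          :+ (:- b) :* (con (+ 1) :- μ :* (:- (con (+ 1) :* (t :* t))))) refl b μ s t)
        (x≈y⇒x-y≈0 -bs²≈μ1) (x≈y⇒x-y≈0 1≈μ[-t²])))

    param-injective : ∀ i j → Proportional (param i) (param j) → i ≡ j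
    param-injective (inj₁ (inj₁ i)) (inj₁ (inj₁ j)) p =
      ≡.cong (inj₁ ∘ inj₁) (enum-inj i j (conicPoint-injective p))
    param-injective (inj₁ (inj₂ i)) (inj₁ (inj₂ j)) p =
      ≡.cong (inj₁ ∘ inj₂) (enum-inj i j (conicPoint-injective
        (swapXY-proportional (param (inj₁ (inj₂ i))) (param (inj₁ (inj₂ j))) p)))
    param-injective (inj₂ Fin.zero) (inj₂ Fin.zero) _ = ≡.refl
    param-injective (inj₁ (inj₁ i)) (inj₁ (inj₂ j)) p = contradiction p (C₁-chart≁Cb-chart (enum i) (enum j))
    param-injective (inj₁ (inj₂ i)) (inj₁ (inj₁ j)) p =
      contradiction (Proportional-sym {param (inj₁ (inj₂ i))} {param (inj₁ (inj₁ j))} p)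
                    (C₁-chart≁Cb-chart (enum j) (enum i))
    param-injective (inj₁ (inj₁ _)) (inj₂ _) (μ , μ≉0 , 0≈μ1 , _)     = contradiction (sym (trans 0≈μ1 (*-identityʳ μ))) μ≉0
    param-injective (inj₁ (inj₂ _)) (inj₂ _) (μ , μ≉0 , _ , 0≈μ1 , _) = contradiction (sym (trans 0≈μ1 (*-identityʳ μ))) μ≉0
    param-injective (inj₂ _) (inj₁ (inj₁ _)) (μ , _ , 1≈μ0 , _)       = contradiction (trans 1≈μ0 (zeroʳ μ)) nontrivial
    param-injective (inj₂ _) (inj₁ (inj₂ _)) (μ , _ , _ , 1≈μ0 , _)   = contradiction (trans 1≈μ0 (zeroʳ μ)) nontrivial

    C₁-chart : ∀ P → Conic 1# P → ¬ Point.x P ≈ 0# → ∃ λ i → Proportional (param i) P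
    C₁-chart P@(pt x y z _) P∈C x≉0 =
      inj₁ (inj₁ (index t)) , conic-chart P P∈C x≉0 (trans (*-congˡ (enum-index t)) (x[zx⁻¹]≈z x x≉0 z))
      where t = z * inv x x≉0

    Cb-chart : ∀ P → Conic b P → ¬ Point.y P ≈ 0# → ∃ λ i → Proportional (param i) P
    Cb-chart P@(pt x y z _) P∈C y≉0 =
      inj₁ (inj₂ (index t)) , swapXY-proportional (conicPoint b (enum (index t))) (swapXY P)
        (conic-chart (swapXY P) (swapXY-conic P P∈C) y≉0
          (trans (*-congˡ (enum-index t)) (x[zx⁻¹]≈z y y≉0 z)))
      where t = z * inv y y≉0

    param-surjective : ∀ P → SetS b P → ∃ λ i → Proportional (param i) P
    param-surjective P@(pt x y z nz) (inj₁ P∈C₁) with x ≈? 0#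
    ... | no  x≉0 = C₁-chart P P∈C₁ x≉0
    ... | yes x≈0 = Cb-chart P (conic-z≈0 P (trans (*-congʳ x≈0) (zeroˡ y)) z≈0) (λ y≈0 → nz (x≈0 , y≈0 , z≈0))
      where z≈0 = conic-x≈0⇒z≈0 P nontrivial P∈C₁ x≈0
    param-surjective P@(pt x y z nz) (inj₂ (inj₁ P∈Cb)) with y ≈? 0#
    ... | no  y≉0 = Cb-chart P P∈Cb y≉0
    ... | yes y≈0 = C₁-chart P (conic-z≈0 P (trans (*-congˡ y≈0) (zeroʳ x)) z≈0) (λ x≈0 → nz (x≈0 , y≈0 , z≈0))
      where z≈0 = conic-x≈0⇒z≈0 (swapXY P) b≉0 (swapXY-conic P P∈Cb) y≈0
    param-surjective (pt x y z nz) (inj₂ (inj₂ (x≈0 , y≈0))) =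
      inj₂ Fin.zero , z , (λ z≈0 → nz (x≈0 , y≈0 , z≈0)) ,
      trans x≈0 (sym (zeroʳ z)) , trans y≈0 (sym (zeroʳ z)) , sym (*-identityʳ z)

    hasSize : HasSize (SetS b) (2 ℕ.* q ℕ.+ 1)
    hasSize = ≡.subst (HasSize (SetS b)) (≡.cong (λ n → q ℕ.+ n ℕ.+ 1) (≡.sym (ℕ.+-identityʳ q)))
      (hasSize-by-parametrisation ((+↔⊎ ⊎-↔ ↔-id _) ↔-∘ +↔⊎) param param∈S param-injective param-surjective)

open import Data.Nat using (_≤_; _*_; _+_)
open import Data.Product using (_×_)

mainTheorem5 : (q : ℕ) → 7 ≤ q → q % 4 ≡ 3 →
    (F : CommutativeRing 0ℓ 0ℓ) → IsFiniteField F q →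
    (b : CommutativeRing.Carrier F) →
    Projective.NonSquare F b →
    Projective.NonSquare F (CommutativeRing._-_ F b (CommutativeRing.1# F)) →
    Projective.Untouchable F (Projective.SetS F b) ×
      Projective.HasSize F (Projective.SetS F b) (2 * q + 1)
mainTheorem5 q _ q%4≡3 F F-finite b b-nonsquare b-1-nonsquare = untouchable , hasSize
  where open ConicPairUnion F-finite q%4≡3 b b-nonsquare b-1-nonsquare
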